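{- For a fixed set $\mathcal{A}$ of exact match anchors between strings $Q$ and $T$, the optimal colinear chaining cost under ChainX precedence $\prec_{\mathtt{ChainX}}$ equals the anchored edit distance and equals the optimal colinear chaining cost under strict precedence $\prec$ and under weak precedence $\prec_{\mathrm{w}}$.
   Context: Strings are 1-indexed; $[x..y]=\{x,\dots,y\}$. An exact match anchor between $Q$ and $T$ is a pair $([q_s..q_e],[t_s..t_e])$ with $1\le q_s\le q_e\le|Q|$, $1\le t_s\le t_e\le|T|$ and $Q[q_s..q_e]=T[t_s..t_e]$. For $a=([q_s..q_e],[t_s..t_e])$, $a'=([q_s'..q_e'],[t_s'..t_e'])$: strict precedence $a\prec a'$ if $q_s\le q_s'$, $q_e\le q_e'$, $t_s\le t_s'$, $t_e\le t_e'$ with at least one strict; weak precedence $a\prec_{\mathrm{w}}a'$ if $q_s\le q_s'$, $t_s\le t_s'$ with at least one strict; ChainX (strong) precedence $a\prec_{\mathtt{ChainX}}a'$ if $q_s<q_s'$, $q_e<q_e'$, $t_s<t_s'$, $t_e<t_e'$. $\mathrm{connect}(a,a')=\max(0,\,q_s'-q_e-1,\,t_s'-t_e-1)+|\max(0,q_e-q_s'+1)-\max(0,t_e-t_s'+1)|$. Under a precedence relation $R$, a colinear chain is a sequence $a_1,\dots,a_c$ of anchors from $\mathcal{A}$ with $a_i\,R\,a_{i+1}$ for all $i$, with cost $\sum_{i=0}^{c}\mathrm{connect}(a_i,a_{i+1})$ where $a_0=([0..0],[0..0])$ and $a_{c+1}=([|Q|+1..|Q|+1],[|T|+1..|T|+1])$;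 the optimal chaining cost is the minimum such cost. Anchored edit distance: a character match $Q[q_s+k]=T[t_s+k]$, $k\in[0..t_e-t_s]$, for some anchor of $\mathcal{A}$ is supported; the anchored edit distance is the minimum cost of an alignment of $Q$ and $T$ in which supported matches cost 0, unsupported matches cost 1, and insertions, deletions and substitutions cost 1. -}

module Defs where

open import Data.Nat using (ℕ; zero; suc; _+_; _∸_; _≤_; _<_; _⊔_; ∣_-_∣)
open import Data.List using (List; []; _∷_)
open import Data.Vec using (Vec; []; _∷_)
open import Data.Maybe using (Maybe; just; nothing)
open import Data.Product using (Σ; _×_; _,_; ∃-syntax)
open import Data.Sum using (_⊎_)
open import Data.List.Membership.Propositional using (_∈_)
open import Data.List.Relation.Unary.All using (All)
open import Data.List.Relation.Unary.Linked using (Linked)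
open import Relation.Binary.PropositionalEquality using (_≡_)
open import Relation.Nullary using (¬_)

-- 1-indexed character access; out-of-range positions give nothing.
charAt : ∀ {A : Set} {m : ℕ} → Vec A m → ℕ → Maybe A
charAt []       _             = nothing
charAt (x ∷ xs) zero          = nothing
charAt (x ∷ xs) (suc zero)    = just x
charAt (x ∷ xs) (suc (suc i)) = charAt xs (suc i)

-- An anchor ([qs..qe],[ts..te]) given by its raw coordinates.
record Anchor : Set where
  constructor anchor
  field
    qs qe ts te : ℕ
open Anchor public

record IsExactMatchAnchor {A : Set} {m n : ℕ} (Q : Vec A m) (T : Vec A n) (a : Anchor) : Set where
  field
    qs≥1  : 1 ≤ qs a
    qs≤qe : qs a ≤ qe a
    qe≤m  : qe a ≤ m
    ts≥1  : 1 ≤ ts a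
    ts≤te : ts a ≤ te a
    te≤n  : te a ≤ n
    sameLength : qe a ∸ qs a ≡ te a ∸ ts a
    sameChars  : ∀ k → k ≤ qe a ∸ qs a → charAt Q (qs a + k) ≡ charAt T (ts a + k)

_≺_ : Anchor → Anchor → Set
a ≺ a' = (qs a ≤ qs a' × qe a ≤ qe a' × ts a ≤ ts a' × te a ≤ te a')
       × (qs a < qs a' ⊎ qe a < qe a' ⊎ ts a < ts a' ⊎ te a < te a')

_≺w_ : Anchor → Anchor → Set
a ≺w a' = (qs a ≤ qs a' × ts a ≤ ts a') × (qs a < qs a' ⊎ ts a < ts a')

_≺ChainX_ : Anchor → Anchor → Set
a ≺ChainX a' = qs a < qs a' × qe a < qe a' × ts a < ts a' × te a < te a'

-- connect(a,a') = max(0, qs'-qe-1, ts'-te-1) + |max(0,qe-qs'+1) - max(0,te-ts'+1)|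
-- (truncated subtraction x ∸ y equals max(0, x - y)).
connect : Anchor → Anchor → ℕ
connect a a' = ((qs a' ∸ suc (qe a)) ⊔ (ts a' ∸ suc (te a)))
             + ∣ (suc (qe a) ∸ qs a') - (suc (te a) ∸ ts a') ∣

startAnchor : Anchor
startAnchor = anchor 0 0 0 0

endAnchor : ℕ → ℕ → Anchor
endAnchor m n = anchor (suc m) (suc m) (suc n) (suc n)

costFrom : Anchor → List Anchor → Anchor → ℕ
costFrom prev []       e = connect prev e
costFrom prev (a ∷ as) e = connect prev a + costFrom a as e

chainCost : ℕ → ℕ → List Anchor → ℕ
chainCost m n as = costFrom startAnchor as (endAnchor m n)

IsChain : (R : Anchor → Anchor → Set) → List Anchor → List Anchor → Set
IsChain R 𝒜 as = All (_∈ 𝒜) as × Linked R as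

IsOptChainCost : (R : Anchor → Anchor → Set) → ℕ → ℕ → List Anchor → ℕ → Set
IsOptChainCost R m n 𝒜 c =
  (Σ (List Anchor) λ as → IsChain R 𝒜 as × chainCost m n as ≡ c)
  × (∀ as → IsChain R 𝒜 as → c ≤ chainCost m n as)

Supported : List Anchor → ℕ → ℕ → Set
Supported 𝒜 i j = ∃[ a ] (a ∈ 𝒜 × ∃[ k ] (k ≤ te a ∸ ts a × i ≡ qs a + k × j ≡ ts a + k))

data Op : Set where
  del ins col : Op

-- AlnCost Q T 𝒜 i j ops c : ops aligns Q[i..m] with T[j..n] at cost c.
-- A column (Q[i],T[j]) costs 0 if it is a supported match, and 1 otherwise
-- (unsupported match or substitution); insertions/deletions cost 1.
data AlnCost {A : Set} {m n : ℕ} (Q : Vec A m) (T : Vec A n) (𝒜 : List Anchor)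
     : ℕ → ℕ → List Op → ℕ → Set where
  done : AlnCost Q T 𝒜 (suc m) (suc n) [] 0
  step-del : ∀ {i j os c} → i ≤ m → AlnCost Q T 𝒜 (suc i) j os c
           → AlnCost Q T 𝒜 i j (del ∷ os) (suc c)
  step-ins : ∀ {i j os c} → j ≤ n → AlnCost Q T 𝒜 i (suc j) os c
           → AlnCost Q T 𝒜 i j (ins ∷ os) (suc c)
  step-sup : ∀ {i j os c} → i ≤ m → j ≤ n → Supported 𝒜 i j
           → AlnCost Q T 𝒜 (suc i) (suc j) os c
           → AlnCost Q T 𝒜 i j (col ∷ os) c
  step-unsup : ∀ {i j os c} → i ≤ m → j ≤ n → ¬ Supported 𝒜 i j
           → AlnCost Q T 𝒜 (suc i) (suc j) os c
           → AlnCost Q T 𝒜 i j (col ∷ os) (suc c)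

IsAnchoredEditDistance : {A : Set} {m n : ℕ} → Vec A m → Vec A n → List Anchor → ℕ → Set
IsAnchoredEditDistance Q T 𝒜 c =
  (Σ (List Op) λ os → AlnCost Q T 𝒜 1 1 os c)
  × (∀ os c' → AlnCost Q T 𝒜 1 1 os c' → c ≤ c')

-- Let jump i j i' j' be the price connect charges for passing from position (i, j)
-- to (i', j'). As a function of the displacement (u, v) = (i' - i, j' - j) it is
-- max(u, v) - min(u, v, 0), which is subadditive; so jump obeys the triangle
-- inequality, and once the target lies behind the source in one coordinate it only
-- depends on the two diagonals involved.
--
-- A chain whose precedence orders anchor starts (as ≺, ≺w and ≺ChainX all do) is
-- realised by an alignment of no greater cost: follow each anchor along its diagonal
-- for free and bridge each gap with jump-many operations. Hence the anchored edit
-- distance, computed by the usual dynamic programme, bounds all three chaining costs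
-- from below.
--
-- Conversely, reading an alignment backwards, one maintains a ChainX chain whose cost
-- from the current position is at most the cost of the rest of the alignment. An
-- unsupported step moves the position by one at cost one. A supported match on an
-- anchor a is absorbed by putting a in front of the chain, or by keeping the chain if
-- its first anchor starts behind the current position, or else (that anchor then ends
-- within a) by dropping that anchor and restarting from the end of a. ChainX chains
-- are also ≺- and ≺w-chains, so all four optima coincide.

module Submission where

open import Defs
open import Data.Nat using (ℕ)
open import Data.List using (List)
open import Data.Vec using (Vec)
open import Data.Product using (Σ; _×_)
open import Data.List.Relation.Unary.All using (All)

open import Data.Sum using (_⊎_; inj₁; inj₂)
import Data.Sum
open import Relation.Binary.PropositionalEquality
open import Data.Integer.Tactic.RingSolver using (solve-∀)

module Displacement where
  open import Data.Integer using (ℤ; 0ℤ; -_; _+_; _-_; _⊔_; _≤_)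
  open import Data.Integer.Properties
  open import Algebra.Properties.CommutativeSemigroup +-commutativeSemigroup using (interchange)

  jumpℤ : ℤ → ℤ → ℤ
  jumpℤ u v = (u ⊔ v) + ((- u ⊔ - v) ⊔ 0ℤ)

  spread : ℤ → ℤ → ℤ
  spread u v = (u ⊔ v) + (- u ⊔ - v)

  ⊔-subadditive : ∀ a b c d → (a + b) ⊔ (c + d) ≤ (a ⊔ c) + (b ⊔ d)
  ⊔-subadditive a b c d =
    ⊔-lub (+-mono-≤ (i≤i⊔j a c) (i≤i⊔j b d)) (+-mono-≤ (i≤j⊔i a c) (i≤j⊔i b d))

  jumpℤ-subadditive : ∀ u₁ v₁ u₂ v₂ → jumpℤ (u₁ + u₂) (v₁ + v₂) ≤ jumpℤ u₁ v₁ + jumpℤ u₂ v₂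
  jumpℤ-subadditive u₁ v₁ u₂ v₂ = begin
    ((u₁ + u₂) ⊔ (v₁ + v₂)) + ((- (u₁ + u₂) ⊔ - (v₁ + v₂)) ⊔ 0ℤ)
      ≡⟨ cong₂ (λ x y → ((u₁ + u₂) ⊔ (v₁ + v₂)) + ((x ⊔ y) ⊔ 0ℤ))
               (neg-distrib-+ u₁ u₂) (neg-distrib-+ v₁ v₂) ⟩
    ((u₁ + u₂) ⊔ (v₁ + v₂)) + (((- u₁ + - u₂) ⊔ (- v₁ + - v₂)) ⊔ (0ℤ + 0ℤ))
      ≤⟨ +-mono-≤ (⊔-subadditive u₁ u₂ v₁ v₂)
                  (≤-trans (⊔-monoˡ-≤ (0ℤ + 0ℤ) (⊔-subadditive (- u₁) (- u₂) (- v₁) (- v₂)))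
                           (⊔-subadditive (- u₁ ⊔ - v₁) (- u₂ ⊔ - v₂) 0ℤ 0ℤ)) ⟩
    ((u₁ ⊔ v₁) + (u₂ ⊔ v₂)) + (((- u₁ ⊔ - v₁) ⊔ 0ℤ) + ((- u₂ ⊔ - v₂) ⊔ 0ℤ))
      ≡⟨ interchange (u₁ ⊔ v₁) (u₂ ⊔ v₂) _ _ ⟩
    jumpℤ u₁ v₁ + jumpℤ u₂ v₂ ∎
    where open ≤-Reasoning

  spread≤jumpℤ : ∀ u v → spread u v ≤ jumpℤ u v
  spread≤jumpℤ u v = +-monoʳ-≤ (u ⊔ v) (i≤i⊔j (- u ⊔ - v) 0ℤ)

  jumpℤ≤spread : ∀ {u v} → u ≤ 0ℤ ⊎ v ≤ 0ℤ → jumpℤ u v ≤ spread u v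
  jumpℤ≤spread {u} {v} behind = +-monoʳ-≤ (u ⊔ v) (⊔-lub ≤-refl (0≤neg behind))
    where
    0≤neg : u ≤ 0ℤ ⊎ v ≤ 0ℤ → 0ℤ ≤ - u ⊔ - v
    0≤neg (inj₁ u≤0) = ≤-trans (neg-mono-≤ u≤0) (i≤i⊔j (- u) (- v))
    0≤neg (inj₂ v≤0) = ≤-trans (neg-mono-≤ v≤0) (i≤j⊔i (- u) (- v))

  spread-translate : ∀ u v t → spread (u + t) (v + t) ≡ spread u v
  spread-translate u v t = begin
    ((u + t) ⊔ (v + t)) + (- (u + t) ⊔ - (v + t))
      ≡⟨ cong₂ (λ x y → ((u + t) ⊔ (v + t)) + (x ⊔ y)) (neg-distrib-+ u t) (neg-distrib-+ v t) ⟩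
    ((u + t) ⊔ (v + t)) + ((- u + - t) ⊔ (- v + - t))
      ≡⟨ cong₂ _+_ (+-distribʳ-⊔ t u v) (+-distribʳ-⊔ (- t) (- u) (- v)) ⟨
    ((u ⊔ v) + t) + ((- u ⊔ - v) + - t)
      ≡⟨ cancel (u ⊔ v) (- u ⊔ - v) t ⟩
    spread u v ∎
    where
    open ≡-Reasoning
    +-distribʳ-⊔ : ∀ t u v → (u ⊔ v) + t ≡ (u + t) ⊔ (v + t)
    +-distribʳ-⊔ t = mono-<-distrib-⊔ (_+ t) (+-monoˡ-< t)
    cancel : ∀ x y t → (x + t) + (y + - t) ≡ x + y
    cancel = solve-∀

  jumpℤ-behind : ∀ {u v} t → u ≤ 0ℤ ⊎ v ≤ 0ℤ → jumpℤ u v ≤ jumpℤ (u + t) (v + t)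
  jumpℤ-behind {u} {v} t behind = begin
    jumpℤ u v               ≤⟨ jumpℤ≤spread behind ⟩
    spread u v              ≡⟨ spread-translate u v t ⟨
    spread (u + t) (v + t)  ≤⟨ spread≤jumpℤ (u + t) (v + t) ⟩
    jumpℤ (u + t) (v + t)   ∎
    where open ≤-Reasoning

open import Data.Nat using (zero; suc; _+_; _∸_; _≤_; _<_; _⊔_; _⊓_; ∣_-_∣; z≤n; s≤s; _≤?_; _<?_; _≟_)
open import Data.Nat.Properties
open import Data.List using ([]; _∷_)
open import Data.Product using (_,_; ∃-syntax; proj₁; proj₂)
open import Data.Empty using (⊥-elim)
open import Data.List.Relation.Unary.All using ([]; _∷_; lookup)
open import Data.List.Relation.Unary.Any using (any?)
open import Data.List.Relation.Unary.Linked as Linked using (Linked; []; [-]; _∷_)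
open import Data.List.Membership.Propositional using (_∈_; find; lose)
open import Function using (_∘_; id)
open import Relation.Nullary using (Dec; yes; no; ¬_)
open import Relation.Nullary.Decidable using (map′; _×-dec_; _⊎-dec_)
import Data.Integer as ℤ
open ℤ using (ℤ; +_; _⊖_)
import Data.Integer.Properties as ℤ
open Displacement

-- connect a a' is definitionally jump (suc (qe a)) (suc (te a)) (qs a') (ts a').
jump : ℕ → ℕ → ℕ → ℕ → ℕ
jump i j i' j' = ((i' ∸ i) ⊔ (j' ∸ j)) + ∣ (i ∸ i') - (j ∸ j') ∣

jump≡jumpℤ⊖ : ∀ i j i' j' → + jump i j i' j' ≡ jumpℤ (i' ⊖ i) (j' ⊖ j)
jump≡jumpℤ⊖ (suc i) j (suc i') j' =
  trans (jump≡jumpℤ⊖ i j i' j') (cong (λ u → jumpℤ u (j' ⊖ j)) (sym (ℤ.[1+m]⊖[1+n]≡m⊖n i' i)))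
jump≡jumpℤ⊖ i (suc j) i' (suc j') =
  trans (jump≡jumpℤ⊖ i j i' j') (cong (jumpℤ (i' ⊖ i)) (sym (ℤ.[1+m]⊖[1+n]≡m⊖n j' j)))
jump≡jumpℤ⊖ zero    zero    zero     zero     = refl
jump≡jumpℤ⊖ zero    zero    zero     (suc j') = refl
jump≡jumpℤ⊖ zero    zero    (suc i') zero     = refl
jump≡jumpℤ⊖ zero    zero    (suc i') (suc j') = refl
jump≡jumpℤ⊖ zero    (suc j) zero     zero     = refl
jump≡jumpℤ⊖ zero    (suc j) (suc i') zero     = refl
jump≡jumpℤ⊖ (suc i) zero    zero     zero     = refl
jump≡jumpℤ⊖ (suc i) zero    zero     (suc j') = refl
jump≡jumpℤ⊖ (suc i) (suc j) zero     zero     = begin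
  + ∣ i - j ∣                  ≡⟨ cong +_ (m⊔n∸m⊓n≡∣m-n∣ i j) ⟨
  + ((i ⊔ j) ∸ (i ⊓ j))        ≡⟨ ℤ.⊖-≥ (m⊓n≤m⊔n i j) ⟨
  (i ⊔ j) ⊖ (i ⊓ j)            ≡⟨ ℤ.[1+m]⊖[1+n]≡m⊖n (i ⊔ j) (i ⊓ j) ⟨
  suc (i ⊔ j) ⊖ suc (i ⊓ j)    ∎
  where
  open ≡-Reasoning
  m⊔n∸m⊓n≡∣m-n∣ : ∀ m n → (m ⊔ n) ∸ (m ⊓ n) ≡ ∣ m - n ∣
  m⊔n∸m⊓n≡∣m-n∣ zero    n       = refl
  m⊔n∸m⊓n≡∣m-n∣ (suc m) zero    = refl
  m⊔n∸m⊓n≡∣m-n∣ (suc m) (suc n) = m⊔n∸m⊓n≡∣m-n∣ m n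

jump≡jumpℤ : ∀ i j i' j' → + jump i j i' j' ≡ jumpℤ (+ i' ℤ.- + i) (+ j' ℤ.- + j)
jump≡jumpℤ i j i' j' =
  trans (jump≡jumpℤ⊖ i j i' j') (sym (cong₂ jumpℤ (ℤ.m-n≡m⊖n i' i) (ℤ.m-n≡m⊖n j' j)))

jump-triangle : ∀ i j i' j' i'' j'' → jump i j i'' j'' ≤ jump i j i' j' + jump i' j' i'' j''
jump-triangle i j i' j' i'' j'' = ℤ.drop‿+≤+ (begin
  + jump i j i'' j''
    ≡⟨ jump≡jumpℤ i j i'' j'' ⟩
  jumpℤ (+ i'' ℤ.- + i) (+ j'' ℤ.- + j)
    ≡⟨ cong₂ jumpℤ (telescope (+ i) (+ i') (+ i'')) (telescope (+ j) (+ j') (+ j'')) ⟩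
  jumpℤ ((+ i' ℤ.- + i) ℤ.+ (+ i'' ℤ.- + i')) ((+ j' ℤ.- + j) ℤ.+ (+ j'' ℤ.- + j'))
    ≤⟨ jumpℤ-subadditive (+ i' ℤ.- + i) (+ j' ℤ.- + j) (+ i'' ℤ.- + i') (+ j'' ℤ.- + j') ⟩
  jumpℤ (+ i' ℤ.- + i) (+ j' ℤ.- + j) ℤ.+ jumpℤ (+ i'' ℤ.- + i') (+ j'' ℤ.- + j')
    ≡⟨ cong₂ ℤ._+_ (jump≡jumpℤ i j i' j') (jump≡jumpℤ i' j' i'' j'') ⟨
  + (jump i j i' j' + jump i' j' i'' j'') ∎)
  where
  open ℤ.≤-Reasoning
  telescope : ∀ a b c → c ℤ.- a ≡ (b ℤ.- a) ℤ.+ (c ℤ.- b)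
  telescope = solve-∀

-- (c + x, c + y) ranges over the diagonal through (x, y). When the target is behind
-- the source in one coordinate, jump is the distance between the two diagonals,
-- which no other pair of points on them beats.
jump-between-diagonals : ∀ {x y x' y'} c d c' d' → d + x' ≤ c + x ⊎ d + y' ≤ c + y →
  jump (c + x) (c + y) (d + x') (d + y') ≤ jump (c' + x) (c' + y) (d' + x') (d' + y')
jump-between-diagonals {x} {y} {x'} {y'} c d c' d' behind = ℤ.drop‿+≤+ (begin
  + jump (c + x) (c + y) (d + x') (d + y')
    ≡⟨ jump≡jumpℤ (c + x) (c + y) (d + x') (d + y') ⟩
  jumpℤ u v
    ≤⟨ jumpℤ-behind t (Data.Sum.map ℤ.i≤j⇒i-j≤0 ℤ.i≤j⇒i-j≤0 (Data.Sum.map ℤ.+≤+ ℤ.+≤+ behind)) ⟩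
  jumpℤ (u ℤ.+ t) (v ℤ.+ t)
    ≡⟨ cong₂ jumpℤ (shift x x') (shift y y') ⟨
  jumpℤ (+ (d' + x') ℤ.- + (c' + x)) (+ (d' + y') ℤ.- + (c' + y))
    ≡⟨ jump≡jumpℤ (c' + x) (c' + y) (d' + x') (d' + y') ⟨
  + jump (c' + x) (c' + y) (d' + x') (d' + y') ∎)
  where
  open ℤ.≤-Reasoning
  u v t : ℤ
  u = + (d + x') ℤ.- + (c + x)
  v = + (d + y') ℤ.- + (c + y)
  t = (+ d' ℤ.- + c') ℤ.- (+ d ℤ.- + c)
  shift′ : ∀ c d c' d' z z' →
           (d' ℤ.+ z') ℤ.- (c' ℤ.+ z) ≡ ((d ℤ.+ z') ℤ.- (c ℤ.+ z)) ℤ.+ ((d' ℤ.- c') ℤ.- (d ℤ.- c))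
  shift′ = solve-∀
  shift : ∀ z z' → + (d' + z') ℤ.- + (c' + z) ≡ (+ (d + z') ℤ.- + (c + z)) ℤ.+ t
  shift z z' = shift′ (+ c) (+ d) (+ c') (+ d') (+ z) (+ z')

jump-ahead : ∀ {i j i' j'} → i ≤ i' → j ≤ j' → jump i j i' j' ≡ (i' ∸ i) ⊔ (j' ∸ j)
jump-ahead i≤i' j≤j' rewrite m≤n⇒m∸n≡0 i≤i' | m≤n⇒m∸n≡0 j≤j' = +-identityʳ _

jump-forward : ∀ i j d e → jump i j (d + i) (e + j) ≡ d ⊔ e
jump-forward i j d e =
  trans (jump-ahead (m≤n+m i d) (m≤n+m j e)) (cong₂ _⊔_ (m+n∸n≡m d i) (m+n∸n≡m e j))

jump-backward : ∀ {x y c d} → d ≤ c → jump (c + x) (c + y) (d + x) (d + y) ≡ 0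
jump-backward {x} {y} {c} {d} d≤c =
  n≤0⇒n≡0 (subst (jump (c + x) (c + y) (d + x) (d + y) ≤_) (jump-forward x y 0 0)
    (jump-between-diagonals c d 0 0 (inj₁ (+-monoˡ-≤ x d≤c))))

len : Anchor → ℕ
len a = suc (qe a ∸ qs a)

module ValidAnchor {A : Set} {m n : ℕ} {Q : Vec A m} {T : Vec A n} {a : Anchor}
                   (valid : IsExactMatchAnchor Q T a) where
  open IsExactMatchAnchor valid

  exitQ : len a + qs a ≡ suc (qe a)
  exitQ = cong suc (m∸n+n≡m qs≤qe)

  exitT : len a + ts a ≡ suc (te a)
  exitT = cong suc (trans (cong (_+ ts a) sameLength) (m∸n+n≡m ts≤te))

  qs≤1+m : qs a ≤ suc m
  qs≤1+m = m≤n⇒m≤1+n (≤-trans qs≤qe qe≤m)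

  ts≤1+n : ts a ≤ suc n
  ts≤1+n = m≤n⇒m≤1+n (≤-trans ts≤te te≤n)

Covers : ℕ → ℕ → Anchor → Set
Covers i j a = ∃[ k ] (k ≤ te a ∸ ts a × i ≡ qs a + k × j ≡ ts a + k)

covers? : ∀ i j a → Dec (Covers i j a)
covers? i j a with qs a ≤? i
... | no qs≰i = no λ (k , _ , i≡ , _) → qs≰i (subst (qs a ≤_) (sym i≡) (m≤m+n (qs a) k))
... | yes qs≤i = map′
  (λ (k≤ , j≡) → i ∸ qs a , k≤ , sym (m+[n∸m]≡n qs≤i) , j≡)
  (λ (k , k≤ , i≡ , j≡) → subst (λ k → k ≤ te a ∸ ts a × j ≡ ts a + k) (sym (offset i≡)) (k≤ , j≡))
  ((i ∸ qs a ≤? te a ∸ ts a) ×-dec (j ≟ ts a + (i ∸ qs a)))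
  where
  offset : ∀ {k} → i ≡ qs a + k → i ∸ qs a ≡ k
  offset {k} i≡ = trans (cong (_∸ qs a) i≡) (m+n∸m≡n (qs a) k)

supported? : ∀ 𝒜 i j → Dec (Supported 𝒜 i j)
supported? 𝒜 i j = map′ find (λ (a , a∈ , covers) → lose a∈ covers) (any? (covers? i j) 𝒜)

_starts≤_ : Anchor → Anchor → Set
a starts≤ b = qs a ≤ qs b × ts a ≤ ts b

OrdersStarts : (Anchor → Anchor → Set) → Set
OrdersStarts R = ∀ {a b} → R a b → a starts≤ b

≺ChainX⇒starts≤ : OrdersStarts _≺ChainX_
≺ChainX⇒starts≤ (qs< , _ , ts< , _) = <⇒≤ qs< , <⇒≤ ts<

≺⇒starts≤ : OrdersStarts _≺_
≺⇒starts≤ ((qs≤ , _ , ts≤ , _) , _) = qs≤ , ts≤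

≺ChainX⇒≺ : ∀ {a b} → a ≺ChainX b → a ≺ b
≺ChainX⇒≺ (qs< , qe< , ts< , te<) = (<⇒≤ qs< , <⇒≤ qe< , <⇒≤ ts< , <⇒≤ te<) , inj₁ qs<

≺ChainX⇒≺w : ∀ {a b} → a ≺ChainX b → a ≺w b
≺ChainX⇒≺w a≺b = ≺ChainX⇒starts≤ a≺b , inj₁ (proj₁ a≺b)

module Alignments {A : Set} {m n : ℕ} (Q : Vec A m) (T : Vec A n) (𝒜 : List Anchor) where

  Aln : ℕ → ℕ → List Op → ℕ → Set
  Aln = AlnCost Q T 𝒜

  aln-bounded : ∀ {i j os c} → Aln i j os c → i ≤ suc m × j ≤ suc n
  aln-bounded done                     = ≤-refl , ≤-refl
  aln-bounded (step-del i≤m al)        = m≤n⇒m≤1+n i≤m , proj₂ (aln-bounded al)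
  aln-bounded (step-ins j≤n al)        = proj₁ (aln-bounded al) , m≤n⇒m≤1+n j≤n
  aln-bounded (step-sup i≤m j≤n _ _)   = m≤n⇒m≤1+n i≤m , m≤n⇒m≤1+n j≤n
  aln-bounded (step-unsup i≤m j≤n _ _) = m≤n⇒m≤1+n i≤m , m≤n⇒m≤1+n j≤n

  aln-i≤m : ∀ {i j os c} → Aln (suc i) j os c → i ≤ m
  aln-i≤m al = ≤-pred (proj₁ (aln-bounded al))

  aln-j≤n : ∀ {i j os c} → Aln i (suc j) os c → j ≤ n
  aln-j≤n al = ≤-pred (proj₂ (aln-bounded al))

  colCost : ℕ → ℕ → ℕ → ℕ
  colCost i j c with supported? 𝒜 i j
  ... | yes _ = c
  ... | no  _ = suc c

  prepend-col : ∀ {i j os c} → i ≤ m → j ≤ n → Aln (suc i) (suc j) os c →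
                Σ (List Op) λ os' → Aln i j os' (colCost i j c)
  prepend-col {i} {j} i≤m j≤n al with supported? 𝒜 i j
  ... | yes sup = _ , step-sup i≤m j≤n sup al
  ... | no ¬sup = _ , step-unsup i≤m j≤n ¬sup al

  colCost-≤-supported : ∀ {i j x c} → Supported 𝒜 i j → x ≤ c → colCost i j x ≤ c
  colCost-≤-supported {i} {j} sup x≤c with supported? 𝒜 i j
  ... | yes _   = x≤c
  ... | no ¬sup = ⊥-elim (¬sup sup)

  colCost-≤-suc : ∀ {i j x c} → x ≤ c → colCost i j x ≤ suc c
  colCost-≤-suc {i} {j} x≤c with supported? 𝒜 i j
  ... | yes _ = m≤n⇒m≤1+n x≤c
  ... | no  _ = s≤s x≤c

  -- r and s count the positions left to align: i + r ≡ suc m and j + s ≡ suc n.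
  opt : ℕ → ℕ → ℕ → ℕ → ℕ
  opt zero    zero    i j = 0
  opt zero    (suc s) i j = suc (opt zero s i (suc j))
  opt (suc r) zero    i j = suc (opt r zero (suc i) j)
  opt (suc r) (suc s) i j = suc (opt r (suc s) (suc i) j) ⊓ suc (opt (suc r) s i (suc j))
                          ⊓ colCost i j (opt r s (suc i) (suc j))

  private
    step : ∀ {i r M} → i + suc r ≡ M → suc i + r ≡ M
    step {i} {r} eq = trans (sym (+-suc i r)) eq

    room : ∀ {i r M} → i + suc r ≡ suc M → i ≤ M
    room {i} {r} eq = ≤-pred (subst (suc i ≤_) (step eq) (m≤m+n (suc i) r))

    at-end : ∀ {i M} → i + 0 ≡ M → i ≡ M
    at-end {i} eq = trans (sym (+-identityʳ i)) eq

    past-end : ∀ {i M} → i ≤ M → i + 0 ≢ suc M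
    past-end i≤M eq = 1+n≰n (subst (_≤ _) (at-end eq) i≤M)

    ⊓-elim : ∀ (P : ℕ → Set) {x y} → P x → P y → P (x ⊓ y)
    ⊓-elim P {x} {y} px py with ⊓-sel x y
    ... | inj₁ x⊓y≡x = subst P (sym x⊓y≡x) px
    ... | inj₂ x⊓y≡y = subst P (sym x⊓y≡y) py

  opt-achieved : ∀ r s {i j} → i + r ≡ suc m → j + s ≡ suc n →
                 Σ (List Op) λ os → Aln i j os (opt r s i j)
  opt-achieved zero zero i≡ j≡ =
    [] , subst₂ (λ i j → Aln i j [] 0) (sym (at-end i≡)) (sym (at-end j≡)) done
  opt-achieved zero (suc s) i≡ j≡ =
    let os , al = opt-achieved zero s i≡ (step j≡) in ins ∷ os , step-ins (room j≡) al
  opt-achieved (suc r) zero i≡ j≡ =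
    let os , al = opt-achieved r zero (step i≡) j≡ in del ∷ os , step-del (room i≡) al
  opt-achieved (suc r) (suc s) {i} {j} i≡ j≡ = ⊓-elim Achieved (⊓-elim Achieved byDel byIns) byCol
    where
    Achieved : ℕ → Set
    Achieved c = Σ (List Op) λ os → Aln i j os c
    byDel : Achieved (suc (opt r (suc s) (suc i) j))
    byDel = let os , al = opt-achieved r (suc s) (step i≡) j≡ in del ∷ os , step-del (room i≡) al
    byIns : Achieved (suc (opt (suc r) s i (suc j)))
    byIns = let os , al = opt-achieved (suc r) s i≡ (step j≡) in ins ∷ os , step-ins (room j≡) al
    byCol : Achieved (colCost i j (opt r s (suc i) (suc j)))
    byCol = prepend-col (room i≡) (room j≡) (proj₂ (opt-achieved r s (step i≡) (step j≡)))

  opt-minimal : ∀ {i j os c} → Aln i j os c → ∀ r s → i + r ≡ suc m → j + s ≡ suc n → opt r s i j ≤ c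
  opt-minimal done zero    zero    _  _  = z≤n
  opt-minimal done zero    (suc s) _  j≡ = ⊥-elim (m+1+n≢m (suc n) j≡)
  opt-minimal done (suc r) _       i≡ _  = ⊥-elim (m+1+n≢m (suc m) i≡)
  opt-minimal (step-del i≤m _)  zero    _       i≡ _  = ⊥-elim (past-end i≤m i≡)
  opt-minimal (step-del _ al)   (suc r) zero    i≡ j≡ = s≤s (opt-minimal al r zero (step i≡) j≡)
  opt-minimal (step-del _ al)   (suc r) (suc s) i≡ j≡ =
    ≤-trans (m⊓n≤m _ _) (≤-trans (m⊓n≤m _ _) (s≤s (opt-minimal al r (suc s) (step i≡) j≡)))
  opt-minimal (step-ins j≤n _)  _       zero    _  j≡ = ⊥-elim (past-end j≤n j≡)
  opt-minimal (step-ins _ al)   zero    (suc s) i≡ j≡ = s≤s (opt-minimal al zero s i≡ (step j≡))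
  opt-minimal (step-ins _ al)   (suc r) (suc s) i≡ j≡ =
    ≤-trans (m⊓n≤m _ _) (≤-trans (m⊓n≤n _ _) (s≤s (opt-minimal al (suc r) s i≡ (step j≡))))
  opt-minimal (step-sup i≤m _ _ _)   zero    _       i≡ _  = ⊥-elim (past-end i≤m i≡)
  opt-minimal (step-sup _ j≤n _ _)   (suc r) zero    _  j≡ = ⊥-elim (past-end j≤n j≡)
  opt-minimal (step-sup _ _ sup al)  (suc r) (suc s) i≡ j≡ =
    ≤-trans (m⊓n≤n _ _) (colCost-≤-supported sup (opt-minimal al r s (step i≡) (step j≡)))
  opt-minimal (step-unsup i≤m _ _ _) zero    _       i≡ _  = ⊥-elim (past-end i≤m i≡)
  opt-minimal (step-unsup _ j≤n _ _) (suc r) zero    _  j≡ = ⊥-elim (past-end j≤n j≡)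
  opt-minimal (step-unsup _ _ _ al)  (suc r) (suc s) i≡ j≡ =
    ≤-trans (m⊓n≤n _ _) (colCost-≤-suc (opt-minimal al r s (step i≡) (step j≡)))

  AlignableWithin : ℕ → ℕ → ℕ → Set
  AlignableWithin i j b = Σ (List Op) λ os → Σ ℕ λ c → Aln i j os c × c ≤ b

  within-mono : ∀ {i j b b'} → b ≤ b' → AlignableWithin i j b → AlignableWithin i j b'
  within-mono b≤b' (os , c , al , c≤b) = os , c , al , ≤-trans c≤b b≤b'

  within-done : AlignableWithin (suc m) (suc n) 0
  within-done = [] , 0 , done , z≤n

  within-del : ∀ {i j b} → AlignableWithin (suc i) j b → AlignableWithin i j (suc b)
  within-del (os , c , al , c≤b) = del ∷ os , suc c , step-del (aln-i≤m al) al , s≤s c≤b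

  within-ins : ∀ {i j b} → AlignableWithin i (suc j) b → AlignableWithin i j (suc b)
  within-ins (os , c , al , c≤b) = ins ∷ os , suc c , step-ins (aln-j≤n al) al , s≤s c≤b

  within-col : ∀ {i j b} → AlignableWithin (suc i) (suc j) b → AlignableWithin i j (suc b)
  within-col {i} {j} (os , c , al , c≤b) =
    let os' , al' = prepend-col (aln-i≤m al) (aln-j≤n al) al
    in os' , colCost i j c , al' , colCost-≤-suc c≤b

  within-sup : ∀ {i j b} → Supported 𝒜 i j → AlignableWithin (suc i) (suc j) b → AlignableWithin i j b
  within-sup sup (os , c , al , c≤b) =
    col ∷ os , c , step-sup (aln-i≤m al) (aln-j≤n al) sup al , c≤b

  within-gap : ∀ d e {i j b} → AlignableWithin (d + i) (e + j) b → AlignableWithin i j ((d ⊔ e) + b)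
  within-gap zero    zero    w = w
  within-gap (suc d) zero    {b = b} w =
    within-mono (≤-reflexive (trans (+-suc (d ⊔ 0) b) (cong (λ x → suc x + b) (⊔-identityʳ d))))
      (within-gap d zero (within-del w))
  within-gap zero    (suc e) {b = b} w =
    within-mono (≤-reflexive (+-suc e b)) (within-gap zero e (within-ins w))
  within-gap (suc d) (suc e) {b = b} w =
    within-mono (≤-reflexive (+-suc (d ⊔ e) b)) (within-gap d e (within-col w))

  within-before : ∀ {i j i' j' b} → i ≤ i' → j ≤ j' →
                  AlignableWithin i' j' b → AlignableWithin i j (jump i j i' j' + b)
  within-before {i} {j} {i'} {j'} {b} i≤i' j≤j' w =
    subst (λ x → AlignableWithin i j (x + b)) (sym (jump-ahead i≤i' j≤j'))
      (within-gap (i' ∸ i) (j' ∸ j)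
        (subst₂ (λ x y → AlignableWithin x y b) (sym (m∸n+n≡m i≤i')) (sym (m∸n+n≡m j≤j')) w))

  within-slide : ∀ L {i j i' j' b} → (∀ k → k < L → Supported 𝒜 (k + i) (k + j)) → i ≤ i' → j ≤ j' →
                 AlignableWithin i' j' b → AlignableWithin i j (jump (L + i) (L + j) i' j' + b)
  within-slide zero    _ i≤i' j≤j' w = within-before i≤i' j≤j' w
  within-slide (suc L) {i} {j} {i'} {j'} {b} diagonal i≤i' j≤j' w with (i' ≤? i) ⊎-dec (j' ≤? j)
  ... | yes behind =
    within-mono (+-monoˡ-≤ b (jump-between-diagonals 0 0 (suc L) 0 behind)) (within-before i≤i' j≤j' w)
  ... | no ahead = within-sup (diagonal 0 (s≤s z≤n))
    (subst₂ (λ x y → AlignableWithin (suc i) (suc j) (jump x y i' j' + b)) (+-suc L i) (+-suc L j)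
      (within-slide L diagonal′ (≰⇒> (ahead ∘ inj₁)) (≰⇒> (ahead ∘ inj₂)) w))
    where
    diagonal′ : ∀ k → k < L → Supported 𝒜 (k + suc i) (k + suc j)
    diagonal′ k k<L =
      subst₂ (Supported 𝒜) (sym (+-suc k i)) (sym (+-suc k j)) (diagonal (suc k) (s≤s k<L))

  entryCost : ℕ → ℕ → List Anchor → ℕ
  entryCost i j []       = jump i j (suc m) (suc n)
  entryCost i j (a ∷ as) = jump i j (qs a) (ts a) + costFrom a as (endAnchor m n)

  chainCost≡entryCost : ∀ as → chainCost m n as ≡ entryCost 1 1 as
  chainCost≡entryCost []      = refl
  chainCost≡entryCost (_ ∷ _) = refl

  costFrom≡entryCost-exit : ∀ {a} → IsExactMatchAnchor Q T a → ∀ as →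
                            costFrom a as (endAnchor m n) ≡ entryCost (len a + qs a) (len a + ts a) as
  costFrom≡entryCost-exit {a} valid as =
    trans (costFrom≡entryCost as) (sym (cong₂ (λ x y → entryCost x y as) exitQ exitT))
    where
    open ValidAnchor valid
    costFrom≡entryCost : ∀ as → costFrom a as (endAnchor m n) ≡ entryCost (suc (qe a)) (suc (te a)) as
    costFrom≡entryCost []      = refl
    costFrom≡entryCost (_ ∷ _) = refl

  entryCost-triangle : ∀ {i j} i' j' as → entryCost i j as ≤ jump i j i' j' + entryCost i' j' as
  entryCost-triangle {i} {j} i' j' []       = jump-triangle i j i' j' (suc m) (suc n)
  entryCost-triangle {i} {j} i' j' (a ∷ as) =
    ≤-trans (+-monoˡ-≤ rest (jump-triangle i j i' j' (qs a) (ts a)))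
            (≤-reflexive (+-assoc (jump i j i' j') (jump i' j' (qs a) (ts a)) rest))
    where
    rest : ℕ
    rest = costFrom a as (endAnchor m n)

  entryCost-forward : ∀ d e {i j} as → entryCost i j as ≤ (d ⊔ e) + entryCost (d + i) (e + j) as
  entryCost-forward d e {i} {j} as =
    subst (λ x → entryCost i j as ≤ x + entryCost (d + i) (e + j) as) (jump-forward i j d e)
      (entryCost-triangle (d + i) (e + j) as)

  entryCost-advance : ∀ {x y c d} → d ≤ c → ∀ as →
                      entryCost (c + x) (c + y) as ≤ entryCost (d + x) (d + y) as
  entryCost-advance {x} {y} {c} {d} d≤c as =
    subst (λ z → entryCost (c + x) (c + y) as ≤ z + entryCost (d + x) (d + y) as) (jump-backward d≤c)
      (entryCost-triangle (d + x) (d + y) as)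

  isAnchoredEditDistance : IsAnchoredEditDistance Q T 𝒜 (opt m n 1 1)
  isAnchoredEditDistance = opt-achieved m n refl refl , λ _ _ al → opt-minimal al m n refl refl

  module _ (valid : All (IsExactMatchAnchor Q T) 𝒜) where

    anchor-supported : ∀ {a} → a ∈ 𝒜 → ∀ k → k < len a → Supported 𝒜 (k + qs a) (k + ts a)
    anchor-supported {a} a∈ k k<len =
      a , a∈ , k , subst (k ≤_) sameLength (≤-pred k<len) , +-comm k (qs a) , +-comm k (ts a)
      where open IsExactMatchAnchor (lookup valid a∈)

    module _ {R : Anchor → Anchor → Set} (orders : OrdersStarts R) where

      within-chain-from : ∀ {a as} → a ∈ 𝒜 → All (_∈ 𝒜) as → Linked R (a ∷ as) →
                          AlignableWithin (qs a) (ts a) (costFrom a as (endAnchor m n))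
      within-chain-from {a} {[]} a∈ [] [-] =
        within-mono (≤-reflexive (trans (+-identityʳ _) (sym (costFrom≡entryCost-exit valid-a []))))
          (within-slide (len a) (anchor-supported a∈) qs≤1+m ts≤1+n within-done)
        where
        valid-a : IsExactMatchAnchor Q T a
        valid-a = lookup valid a∈
        open ValidAnchor valid-a
      within-chain-from {a} {a' ∷ as} a∈ (a'∈ ∷ as∈) (a≺a' ∷ links) =
        subst (AlignableWithin (qs a) (ts a)) (sym (costFrom≡entryCost-exit (lookup valid a∈) (a' ∷ as)))
          (within-slide (len a) (anchor-supported a∈) (proj₁ (orders a≺a')) (proj₂ (orders a≺a'))
            (within-chain-from a'∈ as∈ links))

      within-chain : ∀ {as} → IsChain R 𝒜 as → AlignableWithin 1 1 (chainCost m n as)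
      within-chain {[]} _ =
        within-mono (≤-reflexive (+-identityʳ _)) (within-before (s≤s z≤n) (s≤s z≤n) within-done)
      within-chain {a ∷ as} (a∈ ∷ as∈ , links) =
        within-before qs≥1 ts≥1 (within-chain-from a∈ as∈ links)
        where open IsExactMatchAnchor (lookup valid a∈)

      opt≤chainCost : ∀ {as} → IsChain R 𝒜 as → opt m n 1 1 ≤ chainCost m n as
      opt≤chainCost chain =
        let _ , _ , al , c≤b = within-chain chain in ≤-trans (opt-minimal al m n refl refl) c≤b

    ChainX : List Anchor → Set
    ChainX = IsChain _≺ChainX_ 𝒜

    _≺ChainX?_ : ∀ a b → Dec (a ≺ChainX b)
    a ≺ChainX? b = (qs a <? qs b) ×-dec (qe a <? qe b) ×-dec (ts a <? ts b) ×-dec (te a <? te b)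

    ends-within : ∀ {a b} → ¬ a ≺ChainX b → qs a < qs b → ts a < ts b → qe b ≤ qe a ⊎ te b ≤ te a
    ends-within {a} {b} a⊀b qs< ts< with qe a <? qe b | te a <? te b
    ... | yes qe< | yes te< = ⊥-elim (a⊀b (qs< , qe< , ts< , te<))
    ... | no qe≮  | _       = inj₁ (≮⇒≥ qe≮)
    ... | yes _   | no te≮  = inj₂ (≮⇒≥ te≮)

    entryCost-via-anchor : ∀ {a l} → a ∈ 𝒜 → l ≤ len a → ∀ k as →
                           entryCost (k + qs a) (k + ts a) (a ∷ as) ≤ entryCost (l + qs a) (l + ts a) as
    entryCost-via-anchor {a} a∈ l≤len k as =
      ≤-trans (≤-reflexive (trans (cong (_+ costFrom a as (endAnchor m n)) enter-a)
                                  (costFrom≡entryCost-exit (lookup valid a∈) as)))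
              (entryCost-advance l≤len as)
      where
      enter-a : jump (k + qs a) (k + ts a) (qs a) (ts a) ≡ 0
      enter-a = jump-backward {qs a} {ts a} {k} z≤n

    entryCost-skip : ∀ {a a₁} → a ∈ 𝒜 → a₁ ∈ 𝒜 → qe a₁ ≤ qe a ⊎ te a₁ ≤ te a → ∀ l as →
                     entryCost (len a + qs a) (len a + ts a) as ≤
                     entryCost (l + qs a) (l + ts a) (a₁ ∷ as)
    entryCost-skip {a} {a₁} a∈ a₁∈ ends≤ l as = begin
      entryCost (len a + qs a) (len a + ts a) as
        ≤⟨ entryCost-triangle (len a₁ + qs a₁) (len a₁ + ts a₁) as ⟩
      jump (len a + qs a) (len a + ts a) (len a₁ + qs a₁) (len a₁ + ts a₁)
        + entryCost (len a₁ + qs a₁) (len a₁ + ts a₁) as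
        ≤⟨ +-mono-≤ (jump-between-diagonals (len a) (len a₁) l 0 exits≤)
                    (≤-reflexive (sym (costFrom≡entryCost-exit (lookup valid a₁∈) as))) ⟩
      jump (l + qs a) (l + ts a) (qs a₁) (ts a₁) + costFrom a₁ as (endAnchor m n) ∎
      where
      open ≤-Reasoning
      module V = ValidAnchor (lookup valid a∈)
      module V₁ = ValidAnchor (lookup valid a₁∈)
      exits≤ : len a₁ + qs a₁ ≤ len a + qs a ⊎ len a₁ + ts a₁ ≤ len a + ts a
      exits≤ = Data.Sum.map (λ qe≤ → subst₂ _≤_ (sym V₁.exitQ) (sym V.exitQ) (s≤s qe≤))
                            (λ te≤ → subst₂ _≤_ (sym V₁.exitT) (sym V.exitT) (s≤s te≤)) ends≤

    ChainXWithin : ℕ → ℕ → ℕ → Set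
    ChainXWithin i j b = Σ (List Anchor) λ bs → ChainX bs × entryCost i j bs ≤ b

    chainX-mono : ∀ {i j b b'} → b ≤ b' → ChainXWithin i j b → ChainXWithin i j b'
    chainX-mono b≤b' (bs , chain , cost) = bs , chain , ≤-trans cost b≤b'

    chainX-forward : ∀ d e {i j b} → ChainXWithin (d + i) (e + j) b → ChainXWithin i j ((d ⊔ e) + b)
    chainX-forward d e (bs , chain , cost) =
      bs , chain , ≤-trans (entryCost-forward d e bs) (+-monoʳ-≤ (d ⊔ e) cost)

    retreat-along-anchor : ∀ {a l} → a ∈ 𝒜 → l ≤ len a → ∀ k as → ChainX as →
                           ChainXWithin (k + qs a) (k + ts a) (entryCost (l + qs a) (l + ts a) as)
    retreat-along-anchor {a} a∈ l≤len k [] _ =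
      a ∷ [] , (a∈ ∷ [] , [-]) , entryCost-via-anchor a∈ l≤len k []
    retreat-along-anchor {a} {l} a∈ l≤len k (a₁ ∷ as) (a₁∈ ∷ as∈ , links) with a ≺ChainX? a₁
    ... | yes a≺a₁ =
      a ∷ a₁ ∷ as , (a∈ ∷ a₁∈ ∷ as∈ , a≺a₁ ∷ links) , entryCost-via-anchor a∈ l≤len k (a₁ ∷ as)
    ... | no a⊀a₁ with (qs a₁ ≤? k + qs a) ⊎-dec (ts a₁ ≤? k + ts a)
    ...   | yes behind =
      a₁ ∷ as , (a₁∈ ∷ as∈ , links) , +-monoˡ-≤ _ (jump-between-diagonals k 0 l 0 behind)
    ...   | no ahead =
      chainX-mono (entryCost-skip a∈ a₁∈ (ends-within a⊀a₁ qs< ts<) l as)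
        (retreat-along-anchor a∈ ≤-refl k as (as∈ , Linked.tail links))
      where
      qs< : qs a < qs a₁
      qs< = ≤-<-trans (m≤n+m (qs a) k) (≰⇒> (ahead ∘ inj₁))
      ts< : ts a < ts a₁
      ts< = ≤-<-trans (m≤n+m (ts a) k) (≰⇒> (ahead ∘ inj₂))

    alignment⇒chainX : ∀ {i j os c} → Aln i j os c → ChainXWithin i j c
    alignment⇒chainX done = [] , ([] , []) , ≤-reflexive (jump-forward (suc m) (suc n) 0 0)
    alignment⇒chainX (step-del _ al)       = chainX-forward 1 0 (alignment⇒chainX al)
    alignment⇒chainX (step-ins _ al)       = chainX-forward 0 1 (alignment⇒chainX al)
    alignment⇒chainX (step-unsup _ _ _ al) = chainX-forward 1 1 (alignment⇒chainX al)
    alignment⇒chainX (step-sup _ _ (a , a∈ , k , k≤ , refl , refl) al) =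
      let bs , chain , cost = alignment⇒chainX al
          bs' , chain' , cost' = retreat-along-anchor a∈ k<len k bs chain
      in bs' , chain' , ≤-trans (subst₂ (λ x y → entryCost x y bs' ≤ entryCost (suc x) (suc y) bs)
                                        (+-comm k (qs a)) (+-comm k (ts a)) cost') cost
      where
      open IsExactMatchAnchor (lookup valid a∈)
      k<len : k < len a
      k<len = s≤s (subst (k ≤_) (sym sameLength) k≤)

    isOptChainCost : ∀ {R : Anchor → Anchor → Set} → (∀ {a b} → a ≺ChainX b → R a b) →
                     OrdersStarts R → IsOptChainCost R m n 𝒜 (opt m n 1 1)
    isOptChainCost ChainX⇒R orders =
      let bs , (bs∈ , links) , cost = alignment⇒chainX (proj₂ (opt-achieved m n refl refl))
          chain = bs∈ , Linked.map ChainX⇒R links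
          optimal = subst (_≤ opt m n 1 1) (sym (chainCost≡entryCost bs)) cost
      in (bs , chain , ≤-antisym optimal (opt≤chainCost orders chain)) , λ _ → opt≤chainCost orders

theorem3 : {A : Set} {m n : ℕ} (Q : Vec A m) (T : Vec A n) (𝒜 : List Anchor)
    → All (IsExactMatchAnchor Q T) 𝒜
    → Σ ℕ (λ c → IsOptChainCost _≺ChainX_ m n 𝒜 c
                × IsAnchoredEditDistance Q T 𝒜 c
                × IsOptChainCost _≺_ m n 𝒜 c
                × IsOptChainCost _≺w_ m n 𝒜 c)
theorem3 {m = m} {n = n} Q T 𝒜 valid =
  opt m n 1 1 , isOptChainCost valid {_≺ChainX_} id ≺ChainX⇒starts≤
              , isAnchoredEditDistance
              , isOptChainCost valid {_≺_} ≺ChainX⇒≺ ≺⇒starts≤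
              , isOptChainCost valid {_≺w_} ≺ChainX⇒≺w proj₁
  where open Alignments Q T 𝒜
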